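{- Let $\mathbf{P}(x)\in\mathfrak{S}$ be written as $\mathbf{P}(x)=\mathbf{p}_0(x)+\sum_{\ell=1}^kx^{\mathfrak{c}_\ell}\mathbf{R}_\ell(x^{\mathfrak{d}_\ell})$ with $\mathbf{p}_0(x)\in x\cdot\mathbb{N}[x]$ and each $x^{\mathfrak{c}_\ell}\mathbf{R}_\ell(x^{\mathfrak{d}_\ell})\in\mathfrak{Q}$, and let $\mathfrak{d}$ be a positive integer divisible by all the $\mathfrak{d}_\ell$ ($\mathfrak{d}$ any positive integer if $k=0$). Then $\mathbf{P}(x)$ can be expressed in the form $\mathbf{p}_0(x)+\sum_{i\in I}x^{\mathfrak{c}_i}\mathbf{S}_i(x^{\mathfrak{d}})$, where $I$ is a finite subset of $\mathbb{N}$ and each $x^{\mathfrak{c}_i}\mathbf{S}_i(x^{\mathfrak{d}})$ is in $\mathfrak{Q}$.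
   Context: $\mathsf{RTN}_1$ is the set of $\mathbf{R}(x)=\sum r(n)x^n\in\mathbb{N}[[x]]$ with $r(n)>0$ for all sufficiently large $n$ and $\lim_{n\to\infty}r(n-1)/r(n)=1$. $\mathfrak{S}$ is the set of power series $\mathbf{P}(x)\in x\cdot\mathbb{N}[[x]]\setminus\{0\}$ expressible as $\mathbf{p}_0(x)+\sum_{i=1}^k\mathbf{p}_i(x)\mathbf{R}_i(x^{\mathfrak{d}_i})$ with $\mathbf{p}_i(x)\in\mathbb{N}[x]$ ($0\le i\le k$), $\mathbf{R}_i(x)\in\mathsf{RTN}_1$ and $\mathfrak{d}_i$ positive integers. $\mathfrak{Q}=\{x^{\mathfrak{c}}\mathbf{R}(x^{\mathfrak{d}})\in x\cdot\mathbb{N}[[x]]:\mathfrak{c},\mathfrak{d}\in\mathbb{N},\ \mathbf{R}(x)\in\mathsf{RTN}_1,\ 0\le\mathfrak{c}<\mathfrak{d}\}$. Every member of $\mathfrak{S}$ can be written as a polynomial in $x\cdot\mathbb{N}[x]$ plus a sum of zero or more members of $\mathfrak{Q}$. -}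

module Defs where

open import Data.Nat using (ℕ; zero; suc; _+_; _*_; _∸_; _≤_; _<_; _/_; _%_; ∣_-_∣)
open import Data.Nat.Divisibility using (_∣_)
open import Data.List using (List; []; _∷_; map; foldr)
open import Data.Product using (Σ; ∃; _×_; _,_)
open import Relation.Binary.PropositionalEquality using (_≡_)

-- Formal power series with natural-number coefficients: n ↦ coefficient of x^n.
Series : Set
Series = ℕ → ℕ

_⊕_ : Series → Series → Series
(f ⊕ g) n = f n + g n

zeroS : Series
zeroS _ = 0

sumS : List Series → Series
sumS = foldr _⊕_ zeroS

-- A polynomial in x·ℕ[x], given by its list of coefficients of x^1, x^2, ...
coeffList : List ℕ → ℕ → ℕ
coeffList []       _       = 0
coeffList (a ∷ as) zero    = a
coeffList (a ∷ as) (suc n) = coeffList as n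

polyX : List ℕ → Series
polyX l zero    = 0
polyX l (suc n) = coeffList l n

shift : ℕ → Series → Series
shift zero    S n       = S n
shift (suc c) S zero    = 0
shift (suc c) S (suc n) = shift c S n

-- Substitution x ↦ x^d, i.e. R(x) ↦ R(x^d).  (Only used for d ≥ 1;
-- for d = 0 it is set to the zero series and never used.)
dil : ℕ → Series → Series
dil zero    R n = 0
dil (suc e) R n with n % suc e
... | zero  = R (n / suc e)
... | suc _ = 0

-- RTN_1: r(n) > 0 for all sufficiently large n, and r(n-1)/r(n) → 1.
-- The limit is stated with rational tolerances 1/(m+1):
--   |r(n-1)/r(n) - 1| < 1/(m+1)  ⇔  (m+1)·|r(n-1) - r(n)| < r(n)   (r(n) > 0).
RTN₁ : Series → Set
RTN₁ r =
  (∃ λ N → ∀ n → N ≤ n → 0 < r n) ×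
  (∀ m → ∃ λ N → ∀ n → N ≤ n → suc m * ∣ r (n ∸ 1) - r n ∣ < r n)

-- Data of a member x^c R(x^d) of 𝔔: 0 ≤ c < d, R ∈ RTN_1, and the series
-- lies in x·ℕ[[x]] (zero constant term).
record QData : Set where
  constructor mkQ
  field
    c : ℕ
    d : ℕ
    R : Series
    c<d : c < d
    rtn : RTN₁ R
    noConst : shift c (dil d R) 0 ≡ 0

open QData public

qSeries : QData → Series
qSeries q = shift (c q) (dil (d q) (R q))

form : List ℕ → List QData → Series
form p₀ qs = polyX p₀ ⊕ sumS (map qSeries qs)

module Submission where

-- If d ∣ 𝔡, write 𝔡 = M·d.  Splitting the exponents a of R(x^d) by their
-- residue j = a mod M, i.e. a = j + b·M, gives
--     x^c R(x^d)  =  Σ_{j<M} x^{c + j·d} R_j(x^𝔡),      R_j(t) = R(M·t + j),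
-- and c + j·d < (j+1)·d ≤ 𝔡, so each summand is again in 𝔔 as soon as R_j is
-- in RTN₁.  The latter holds because RTN₁ is closed under passing to an
-- arithmetic subsequence: consecutive ratios of R_j are ratios of R at lag M,
-- and these are controlled by telescoping M consecutive ratios of R.

open import Defs
open import Data.Nat using (ℕ; _<_)
open import Data.Nat.Divisibility using (_∣_)
open import Data.List using (List)
open import Data.List.Relation.Unary.All using (All)
open import Data.Product using (∃; _×_)
open import Relation.Binary.PropositionalEquality using (_≡_)

open import Data.Nat using (zero; suc; _+_; _*_; _∸_; _≤_; _^_; z≤n; s≤s; _/_; _%_; ∣_-_∣)
open import Data.Nat.Properties
open import Data.Nat.DivMod using (m*n%n≡0; m*n/n≡m; m%n<n; m≡m%n+[m/n]*n; [m+kn]%n≡m%n; m<n⇒m%n≡m)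
open import Data.Nat.Divisibility using (divides; _∣?_; m%n≡0⇒n∣m)
open import Data.Nat.Tactic.RingSolver using (solve-∀)
open import Data.List using ([]; _∷_; _++_; map)
open import Data.List.Relation.Unary.All using ([]; _∷_)
open import Data.List.Relation.Unary.All.Properties using (++⁺)
open import Data.Product using (_,_; proj₁; proj₂)
open import Data.Sum using (inj₁; inj₂)
open import Relation.Binary.PropositionalEquality using (refl; sym; trans; cong; cong₂; subst; _≢_; ≢-sym; module ≡-Reasoning)
open import Relation.Nullary using (Dec; yes; no; ¬_; contradiction)

sumTo : ℕ → (ℕ → ℕ) → ℕ
sumTo zero    g = 0
sumTo (suc k) g = g k + sumTo k g

sumTo-zero : ∀ k g → (∀ j → j < k → g j ≡ 0) → sumTo k g ≡ 0
sumTo-zero zero    g vanish = refl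
sumTo-zero (suc k) g vanish =
  cong₂ _+_ (vanish k ≤-refl) (sumTo-zero k g (λ j j<k → vanish j (m≤n⇒m≤1+n j<k)))

sumTo-single : ∀ k g j₀ → j₀ < k → (∀ j → j < k → j ≢ j₀ → g j ≡ 0) → sumTo k g ≡ g j₀
sumTo-single (suc k) g j₀ j₀<1+k vanish with k ≟ j₀
... | yes refl = trans (cong (g k +_) rest) (+-identityʳ (g k))
  where
  rest : sumTo k g ≡ 0
  rest = sumTo-zero k g (λ j j<k → vanish j (m≤n⇒m≤1+n j<k) (λ { refl → <-irrefl refl j<k }))
... | no k≢j₀ = cong₂ _+_ (vanish k ≤-refl k≢j₀)
                  (sumTo-single k g j₀ (≤∧≢⇒< (≤-pred j₀<1+k) (≢-sym k≢j₀))
                    (λ j j<k → vanish j (m≤n⇒m≤1+n j<k)))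

sumTo≡0⇒term≡0 : ∀ k g j → sumTo k g ≡ 0 → j < k → g j ≡ 0
sumTo≡0⇒term≡0 (suc k) g j sum≡0 (s≤s j≤k) with m≤n⇒m<n∨m≡n j≤k
... | inj₁ j<k  = sumTo≡0⇒term≡0 k g j (m+n≡0⇒n≡0 (g k) sum≡0) j<k
... | inj₂ refl = m+n≡0⇒m≡0 (g j) sum≡0

-- The coefficients of x^c S(x^D) are supported on the grid c + Dℕ.
OnGrid : ℕ → ℕ → ℕ → Set
OnGrid c D n = ∃ λ a → n ≡ c + a * D

onGrid? : ∀ c e n → Dec (OnGrid c (suc e) n)
onGrid? c e n with c ≤? n
... | no c≰n = no λ { (a , refl) → c≰n (m≤m+n c (a * suc e)) }
... | yes c≤n with suc e ∣? (n ∸ c)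
...   | yes (divides a eq) = yes (a , trans (sym (m+[n∸m]≡n c≤n)) (cong (c +_) eq))
...   | no ∤ = no λ { (a , refl) → ∤ (divides a (m+n∸m≡n c (a * suc e))) }

shift-ge : ∀ c S n → shift c S (c + n) ≡ S n
shift-ge zero    S n = refl
shift-ge (suc c) S n = shift-ge c S n

shift-lt : ∀ c S n → n < c → shift c S n ≡ 0
shift-lt (suc c) S zero    _         = refl
shift-lt (suc c) S (suc n) (s≤s n<c) = shift-lt c S n n<c

dil-on : ∀ e S a → dil (suc e) S (a * suc e) ≡ S a
dil-on e S a with (a * suc e) % suc e | m*n%n≡0 a (suc e)
... | zero | _ = cong S (m*n/n≡m a (suc e))

dil-off : ∀ e S n → ¬ (suc e ∣ n) → dil (suc e) S n ≡ 0
dil-off e S n ∤ with n % suc e in eq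
... | zero  = contradiction (m%n≡0⇒n∣m n (suc e) eq) ∤
... | suc _ = refl

shiftDil-on : ∀ c e S a → shift c (dil (suc e) S) (c + a * suc e) ≡ S a
shiftDil-on c e S a = trans (shift-ge c (dil (suc e) S) (a * suc e)) (dil-on e S a)

shiftDil-off : ∀ c e S n → ¬ OnGrid c (suc e) n → shift c (dil (suc e) S) n ≡ 0
shiftDil-off c e S n off with c ≤? n
... | no c≰n  = shift-lt c (dil (suc e) S) n (≰⇒> c≰n)
... | yes c≤n = begin
    shift c (dil (suc e) S) n         ≡⟨ cong (shift c (dil (suc e) S)) (sym n≡) ⟩
    shift c (dil (suc e) S) (c + r)   ≡⟨ shift-ge c (dil (suc e) S) r ⟩
    dil (suc e) S r                   ≡⟨ dil-off e S r (λ { (divides a eq) → off (a , trans (sym n≡) (cong (c +_) eq)) }) ⟩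
    0                                 ∎
  where
  open ≡-Reasoning
  r : ℕ
  r = n ∸ c
  n≡ : c + r ≡ n
  n≡ = m+[n∸m]≡n c≤n

grid-injective : ∀ c e a a′ → c + a * suc e ≡ c + a′ * suc e → a ≡ a′
grid-injective c e a a′ eq = *-cancelʳ-≡ a a′ (suc e) (+-cancelˡ-≡ c _ _ eq)

module Splitting (c e μ : ℕ) (S : Series) where

  δ M Δ : ℕ
  δ = suc e
  M = suc μ
  Δ = M * δ

  residueSeries : ℕ → Series
  residueSeries j t = S (M * t + j)

  piece : ℕ → Series
  piece j = shift (c + j * δ) (dil Δ (residueSeries j))

  -- The grid point b of piece j is the grid point j + bM of x^c S(x^δ).
  regroup : ∀ j b → c + j * δ + b * Δ ≡ c + (j + b * M) * δ
  regroup j b = law c j b M δ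
    where
    law : ∀ c j b M δ → c + j * δ + b * (M * δ) ≡ c + (j + b * M) * δ
    law = solve-∀

  split-identity : ∀ n → shift c (dil δ S) n ≡ sumTo M (λ j → piece j n)
  split-identity n with onGrid? c e n
  ... | no off = trans (shiftDil-off c e S n off) (sym (sumTo-zero M (λ j → piece j n) vanish))
    where
    vanish : ∀ j → j < M → piece j n ≡ 0
    vanish j _ = shiftDil-off (c + j * δ) _ (residueSeries j) n
                   (λ { (b , eq) → off (j + b * M , trans eq (regroup j b)) })
  ... | yes (a , refl) = sym (begin
      sumTo M (λ j → piece j n)    ≡⟨ sumTo-single M (λ j → piece j n) j₀ (m%n<n a M) vanish ⟩
      piece j₀ n                   ≡⟨ cong (piece j₀) (sym (trans (regroup j₀ b) (cong (λ x → c + x * δ) (sym a≡)))) ⟩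
      piece j₀ (c + j₀ * δ + b * Δ) ≡⟨ shiftDil-on (c + j₀ * δ) _ (residueSeries j₀) b ⟩
      S (M * b + j₀)               ≡⟨ cong S (trans (+-comm (M * b) j₀) (trans (cong (j₀ +_) (*-comm M b)) (sym a≡))) ⟩
      S a                          ≡⟨ sym (shiftDil-on c e S a) ⟩
      shift c (dil δ S) n          ∎)
    where
    open ≡-Reasoning
    j₀ b : ℕ
    j₀ = a % M
    b = a / M
    a≡ : a ≡ j₀ + b * M
    a≡ = m≡m%n+[m/n]*n a M
    -- a grid point of piece j is a grid point j + b′M, whose residue is j
    vanish : ∀ j → j < M → j ≢ j₀ → piece j n ≡ 0
    vanish j j<M j≢j₀ = shiftDil-off (c + j * δ) _ (residueSeries j) n λ { (b′ , eq) →
      j≢j₀ (begin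
        j                 ≡⟨ sym (m<n⇒m%n≡m j<M) ⟩
        j % M             ≡⟨ sym ([m+kn]%n≡m%n j b′ M) ⟩
        (j + b′ * M) % M  ≡⟨ cong (_% M) (sym (grid-injective c e a (j + b′ * M) (trans eq (regroup j b′)))) ⟩
        j₀                ∎) }

module Window (S : Series) (N m : ℕ)
  (ratio : ∀ n → N ≤ n → suc m * ∣ S (n ∸ 1) - S n ∣ < S n) where

  step-back : ∀ t → N ≤ t → S (t ∸ 1) ≤ 2 * S t
  step-back t N≤t = begin
    S (t ∸ 1)                      ≤⟨ m≤n+∣m-n∣ (S (t ∸ 1)) (S t) ⟩
    S t + ∣ S (t ∸ 1) - S t ∣       ≤⟨ +-monoʳ-≤ (S t) (<⇒≤ diff<) ⟩
    S t + S t                      ≡⟨ cong (S t +_) (sym (+-identityʳ (S t))) ⟩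
    2 * S t                        ∎
    where
    open ≤-Reasoning
    diff< : ∣ S (t ∸ 1) - S t ∣ < S t
    diff< = ≤-<-trans (m≤m+n _ (m * ∣ S (t ∸ 1) - S t ∣)) (ratio t N≤t)

  back-index : ∀ n i → S (n ∸ suc i) ≡ S ((n ∸ i) ∸ 1)
  back-index n i = cong S (sym (trans (∸-+-assoc n i 1) (cong (n ∸_) (+-comm i 1))))

  back-bound : ∀ i n → N + i ≤ n → S (n ∸ i) ≤ 2 ^ i * S n
  back-bound zero    n _  = ≤-reflexive (sym (+-identityʳ (S n)))
  back-bound (suc i) n le = begin
    S (n ∸ suc i)      ≡⟨ back-index n i ⟩
    S ((n ∸ i) ∸ 1)    ≤⟨ step-back (n ∸ i) (m+n≤o⇒m≤o∸n N le′) ⟩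
    2 * S (n ∸ i)      ≤⟨ *-monoʳ-≤ 2 (back-bound i n le′) ⟩
    2 * (2 ^ i * S n)  ≡⟨ sym (*-assoc 2 (2 ^ i) (S n)) ⟩
    2 ^ suc i * S n    ∎
    where
    open ≤-Reasoning
    le′ : N + i ≤ n
    le′ = ≤-trans (+-monoʳ-≤ N (n≤1+n i)) le

  telescope : ∀ K i n → N + i ≤ n → i ≤ K → suc m * ∣ S (n ∸ i) - S n ∣ ≤ i * (2 ^ K * S n)
  telescope K zero    n _  _   = ≤-reflexive (trans (cong (suc m *_) (∣n-n∣≡0 (S n))) (*-zeroʳ (suc m)))
  telescope K (suc i) n le i<K = begin
    L * ∣ S (n ∸ suc i) - S n ∣                 ≡⟨ cong (λ z → L * ∣ z - S n ∣) (back-index n i) ⟩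
    L * ∣ S (t ∸ 1) - S n ∣                     ≤⟨ *-monoʳ-≤ L (∣-∣-triangle (S (t ∸ 1)) (S t) (S n)) ⟩
    L * (∣ S (t ∸ 1) - S t ∣ + ∣ S t - S n ∣)    ≡⟨ *-distribˡ-+ L ∣ S (t ∸ 1) - S t ∣ ∣ S t - S n ∣ ⟩
    L * ∣ S (t ∸ 1) - S t ∣ + L * ∣ S t - S n ∣  ≤⟨ +-mono-≤ (<⇒≤ (ratio t (m+n≤o⇒m≤o∸n N le′))) (telescope K i n le′ (<⇒≤ i<K)) ⟩
    S t + i * B                                ≤⟨ +-monoˡ-≤ (i * B) St≤B ⟩
    B + i * B                                  ∎
    where
    open ≤-Reasoning
    L t B : ℕ
    L = suc m
    t = n ∸ i
    B = 2 ^ K * S n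
    le′ : N + i ≤ n
    le′ = ≤-trans (+-monoʳ-≤ N (n≤1+n i)) le
    St≤B : S t ≤ B
    St≤B = ≤-trans (back-bound i n le′) (*-monoˡ-≤ (S n) (^-monoʳ-≤ 2 (<⇒≤ i<K)))

lagged-ratio : ∀ S → RTN₁ S → ∀ μ m →
  ∃ λ N → ∀ n → N ≤ n → suc m * ∣ S (n ∸ suc μ) - S n ∣ < S n
lagged-ratio S (_ , lim) μ m = N + M , bound
  where
  M Q m′ N : ℕ
  M = suc μ
  Q = M * 2 ^ M
  m′ = Q + m * suc Q        -- so that m′ + 1 = (m + 1)(Q + 1)
  N = proj₁ (lim m′)
  open Window S N m′ (proj₂ (lim m′))

  bound : ∀ n → N + M ≤ n → suc m * ∣ S (n ∸ M) - S n ∣ < S n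
  bound n le = *-cancelˡ-< (suc Q) _ _ (begin-strict
    suc Q * (suc m * X)  ≡⟨ trans (sym (*-assoc (suc Q) (suc m) X)) (cong (_* X) (*-comm (suc Q) (suc m))) ⟩
    suc m′ * X           ≤⟨ telescope M M n le ≤-refl ⟩
    M * (2 ^ M * S n)    ≡⟨ sym (*-assoc M (2 ^ M) (S n)) ⟩
    Q * S n              <⟨ +-monoˡ-< (Q * S n) Sn>0 ⟩
    suc Q * S n          ∎)
    where
    open ≤-Reasoning
    X : ℕ
    X = ∣ S (n ∸ M) - S n ∣
    Sn>0 : 0 < S n
    Sn>0 = ≤-<-trans z≤n (proj₂ (lim m′) n (≤-trans (m≤m+n N M) le))

lag-index : ∀ μ k j → suc μ * suc k + j ∸ suc μ ≡ suc μ * k + j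
lag-index μ k j = begin
  suc μ * suc k + j ∸ suc μ        ≡⟨ cong (λ z → z + j ∸ suc μ) (*-suc (suc μ) k) ⟩
  suc μ + suc μ * k + j ∸ suc μ    ≡⟨ cong (_∸ suc μ) (+-assoc (suc μ) (suc μ * k) j) ⟩
  suc μ + (suc μ * k + j) ∸ suc μ  ≡⟨ m+n∸m≡n (suc μ) (suc μ * k + j) ⟩
  suc μ * k + j                    ∎
  where open ≡-Reasoning

rtn-sub : ∀ μ j S → RTN₁ S → RTN₁ (λ t → S (suc μ * t + j))
rtn-sub μ j S rtn@((N₀ , pos) , _) = (N₀ , eventually-pos) , ratio
  where
  index-grows : ∀ t → t ≤ suc μ * t + j
  index-grows t = ≤-trans (m≤m+n t (μ * t)) (m≤m+n (suc μ * t) j)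

  eventually-pos : ∀ t → N₀ ≤ t → 0 < S (suc μ * t + j)
  eventually-pos t N₀≤t = pos _ (≤-trans N₀≤t (index-grows t))

  ratio : ∀ m → ∃ λ N → ∀ t → N ≤ t →
    suc m * ∣ S (suc μ * (t ∸ 1) + j) - S (suc μ * t + j) ∣ < S (suc μ * t + j)
  ratio m with lagged-ratio S rtn μ m
  ... | N , lagged = suc N , λ where
    (suc k) (s≤s N≤k) → subst (λ i → suc m * ∣ S i - S (suc μ * suc k + j) ∣ < S (suc μ * suc k + j))
                          (lag-index μ k j)
                          (lagged _ (≤-trans N≤k (≤-trans (n≤1+n k) (index-grows (suc k)))))

module Refinement (c e μ : ℕ) (S : Series) (c<δ : c < suc e) (rtn : RTN₁ S)
  (noConst : shift c (dil (suc e) S) 0 ≡ 0) where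
  open Splitting c e μ S public

  piece-exponent< : ∀ j → j < M → c + j * δ < Δ
  piece-exponent< j j<M = ≤-trans (+-monoˡ-< (j * δ) c<δ) (*-monoˡ-≤ δ j<M)

  -- the constant term of the whole is the sum of those of the pieces
  piece-noConst : ∀ j → j < M → piece j 0 ≡ 0
  piece-noConst j = sumTo≡0⇒term≡0 M (λ j → piece j 0) j (trans (sym (split-identity 0)) noConst)

  pieceQ : ∀ j → j < M → QData
  pieceQ j j<M = mkQ (c + j * δ) Δ (residueSeries j) (piece-exponent< j j<M)
                   (rtn-sub μ j S rtn) (piece-noConst j j<M)

  pieces : ∀ k → k ≤ M → List QData
  pieces zero    _   = []
  pieces (suc k) k<M = pieceQ k k<M ∷ pieces k (<⇒≤ k<M)

  pieces-exponent : ∀ k k≤M → All (λ s → d s ≡ Δ) (pieces k k≤M)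
  pieces-exponent zero    _   = []
  pieces-exponent (suc k) k<M = refl ∷ pieces-exponent k (<⇒≤ k<M)

  pieces-sum : ∀ k k≤M n → sumS (map qSeries (pieces k k≤M)) n ≡ sumTo k (λ j → piece j n)
  pieces-sum zero    _   n = refl
  pieces-sum (suc k) k<M n = cong (piece k n +_) (pieces-sum k (<⇒≤ k<M) n)

refine : (q : QData) (f : ℕ) → d q ∣ suc f →
  ∃ λ (ss : List QData) → All (λ s → d s ≡ suc f) ss ×
    (∀ n → qSeries q n ≡ sumS (map qSeries ss) n)
refine (mkQ c (suc e) S c<δ rtn noConst) f (divides (suc μ) refl) =
  pieces M ≤-refl , pieces-exponent M ≤-refl ,
  λ n → trans (split-identity n) (sym (pieces-sum M ≤-refl n))
  where
  open Refinement c e μ S c<δ rtn noConst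

sumS-++ : ∀ xs ys n →
  sumS (map qSeries (xs ++ ys)) n ≡ sumS (map qSeries xs) n + sumS (map qSeries ys) n
sumS-++ []       ys n = refl
sumS-++ (x ∷ xs) ys n = trans (cong (qSeries x n +_) (sumS-++ xs ys n)) (sym (+-assoc (qSeries x n) _ _))

lemma4p6 : (p₀ : List ℕ) (qs : List QData) (𝔡 : ℕ) → 0 < 𝔡 →
    All (λ q → d q ∣ 𝔡) qs →
    ∃ λ (ss : List QData) → All (λ s → d s ≡ 𝔡) ss ×
    (∀ n → form p₀ qs n ≡ form p₀ ss n)
lemma4p6 p₀ []       𝔡       _   []           = [] , [] , λ n → refl
lemma4p6 p₀ (q ∷ qs) (suc f) 0<𝔡 (q∣𝔡 ∷ qs∣𝔡)
  with lemma4p6 p₀ qs (suc f) 0<𝔡 qs∣𝔡 | refine q f q∣𝔡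
... | ss , ss-exp , qs≗ss | rs , rs-exp , q≗rs = rs ++ ss , ++⁺ rs-exp ss-exp , λ n → begin
    polyX p₀ n + (qSeries q n + sumS (map qSeries qs) n)
      ≡⟨ cong₂ (λ a b → polyX p₀ n + (a + b)) (q≗rs n) (+-cancelˡ-≡ (polyX p₀ n) _ _ (qs≗ss n)) ⟩
    polyX p₀ n + (sumS (map qSeries rs) n + sumS (map qSeries ss) n)
      ≡⟨ cong (polyX p₀ n +_) (sym (sumS-++ rs ss n)) ⟩
    polyX p₀ n + sumS (map qSeries (rs ++ ss)) n ∎
  where open ≡-Reasoning
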